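{- Let $T$ be a basic tournament. Then $T\notin\mathcal{D}_1$.
   Context: A tournament is a digraph with exactly one arc between each pair of distinct vertices. Skew-adjacency matrix $S_T$ w.r.t. an ordering $v_1,\dots,v_n$: entry $1$ if $v_i\to v_j$, $-1$ if $v_j\to v_i$, $0$ on the diagonal; $\det(T)=\det(S_T)$. $\mathcal{D}_1$ is the set of tournaments all of whose induced subtournaments have determinant at most $1$. For distinct vertices write $\theta_T(u,v)=1$ if $u\to v$, $-1$ otherwise. Two vertices $u_1,u_2$ of $T$ (with $|V(T)|\ge3$) are CR-associated if either $\theta_T(u_1,v)=\theta_T(u_2,v)$ for all $v\in V(T)\setminus\{u_1,u_2\}$ or $\theta_T(u_1,v)=-\theta_T(u_2,v)$ for all such $v$. A tournament of order at least $4$ is basic if no two of its vertices are CR-associated. -}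

module Defs where

open import Data.Nat using (ℕ; zero; suc; _≥_)
open import Data.Fin using (Fin; zero; suc; toℕ; punchIn; _≟_)
open import Data.Bool using (Bool; true; false; not; if_then_else_)
open import Data.Integer using (ℤ; +_; -_; _+_; _*_; _≤_)
open import Data.Sum using (_⊎_)
open import Relation.Nullary using (¬_; yes; no)
open import Relation.Binary.PropositionalEquality using (_≡_; _≢_)
open import Function.Definitions using (Injective)

sgn : ℕ → ℤ
sgn zero = + 1
sgn (suc k) = - sgn k

sumFin : ∀ {n} → (Fin n → ℤ) → ℤ
sumFin {zero} f = + 0
sumFin {suc n} f = f zero + sumFin (λ i → f (suc i))

det : ∀ {n} → (Fin n → Fin n → ℤ) → ℤ
det {zero} M = + 1
det {suc n} M =
  sumFin (λ j → sgn (toℕ j) * (M zero j * det (λ r c → M (suc r) (punchIn j c))))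

-- A tournament on vertex set Fin n: beats u v = true means u → v.
-- For distinct vertices exactly one arc; the diagonal value is irrelevant.
record Tournament (n : ℕ) : Set where
  field
    beats : Fin n → Fin n → Bool
    tourn : ∀ u v → u ≢ v → beats v u ≡ not (beats u v)
open Tournament public

θ : ∀ {n} → Tournament n → Fin n → Fin n → ℤ
θ T u v = if beats T u v then + 1 else - (+ 1)

skew : ∀ {n} → Tournament n → Fin n → Fin n → ℤ
skew T i j with i ≟ j
... | yes _ = + 0
... | no _ = θ T i j

subDet : ∀ {n k} → Tournament n → (Fin k → Fin n) → ℤ
subDet T f = det (λ i j → skew T (f i) (f j))

InD1 : ∀ {n} → Tournament n → Set
InD1 {n} T = ∀ (k : ℕ) (f : Fin k → Fin n) → Injective _≡_ _≡_ f → subDet T f ≤ + 1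

CRAssociated : ∀ {n} → Tournament n → Fin n → Fin n → Set
CRAssociated {n} T u₁ u₂ =
  (∀ (v : Fin n) → v ≢ u₁ → v ≢ u₂ → θ T u₁ v ≡ θ T u₂ v)
  ⊎ (∀ (v : Fin n) → v ≢ u₁ → v ≢ u₂ → θ T u₁ v ≡ - θ T u₂ v)

Basic : ∀ {n} → Tournament n → Set
Basic {n} T = (n ≥ 4) × (∀ u₁ u₂ → u₁ ≢ u₂ → ¬ CRAssociated T u₁ u₂)
  where open import Data.Product using (_×_)

-- Switch T at the out-neighbourhood of vertex 0, i.e. reverse every arc between that set and
-- its complement, so that 0 becomes a sink.  If T ∈ 𝒟₁ the switched tournament has no cyclic
-- triangle: one avoiding 0 would span, together with 0, a 4-vertex subtournament of T whose
-- Pfaffian is ±3, hence of determinant 9.  So the switched tournament is transitive, and its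
-- two top vertices have identical out-arcs to all other vertices.  Switching changes θ(u, v)
-- by a factor ε(u) ε(v), so in T the rows of these two vertices differ by the constant sign
-- ε(u₁) ε(u₂): they are CR-associated.
module Submission where

open import Defs
open import Data.Nat using (ℕ; zero; suc; s≤s)
open import Data.Fin using (Fin; zero; suc; toℕ; punchIn; punchOut; _≟_)
open import Data.Fin.Properties using (suc-injective; punchIn-injective; punchInᵢ≢i; punchIn-punchOut)
open import Data.Bool using (Bool; true; false; not; _xor_; if_then_else_)
open import Data.Bool.Properties using (not-injective; not-involutive; not-distribˡ-xor; not-distribʳ-xor; xor-comm; xor-same)
import Data.Bool.Properties as Bool
open import Data.Integer using (ℤ; +_; -_; _+_; _*_; _≤_; +≤+)
open import Data.Vec using (Vec; []; _∷_; lookup)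
open import Data.Vec.Relation.Unary.All using ([]; _∷_)
open import Data.Vec.Relation.Unary.AllPairs using ([]; _∷_)
open import Data.Vec.Relation.Unary.Unique.Propositional using (Unique)
open import Data.Vec.Relation.Unary.Unique.Propositional.Properties using (lookup-injective)
open import Data.Sum using (inj₁; inj₂)
open import Data.Product using (_×_; _,_; ∃; ∃₂)
open import Data.Empty using (⊥; ⊥-elim)
open import Function using (_∘_)
open import Relation.Nullary using (¬_; yes; no)
open import Relation.Binary.PropositionalEquality using (_≡_; _≢_; refl; sym; trans; cong; cong₂; subst; module ≡-Reasoning)
open import Function.Definitions using (Injective)

sign : Bool → ℤ
sign b = if b then + 1 else - (+ 1)

sign-not : ∀ b → sign (not b) ≡ - sign b
sign-not true = refl
sign-not false = refl

xor-cancelˡ : ∀ x {y z} → x xor y ≡ x xor z → y ≡ z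
xor-cancelˡ false eq = eq
xor-cancelˡ true eq = not-injective eq

xor≡true⇒≡not : ∀ x {y} → x xor y ≡ true → y ≡ not x
xor≡true⇒≡not false eq = eq
xor≡true⇒≡not true {false} refl = refl
xor≡true⇒≡not true {true} ()

module _ {n : ℕ} (T : Tournament n) where

  θ-flip : ∀ {u v} → u ≢ v → θ T v u ≡ - θ T u v
  θ-flip {u} {v} u≢v = trans (cong sign (tourn T u v u≢v)) (sign-not (beats T u v))

  skew-diag : ∀ u → skew T u u ≡ + 0
  skew-diag u with u ≟ u
  ... | yes _ = refl
  ... | no u≢u = ⊥-elim (u≢u refl)

  skew-offDiag : ∀ {u v} → u ≢ v → skew T u v ≡ θ T u v
  skew-offDiag {u} {v} u≢v with u ≟ v
  ... | yes u≡v = ⊥-elim (u≢v u≡v)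
  ... | no _ = refl

  beats-flip : ∀ {u v} → u ≢ v → beats T u v ≡ false → beats T v u ≡ true
  beats-flip {u} {v} u≢v u↛v = trans (tourn T u v u≢v) (cong not u↛v)

  Acyclic : Set
  Acyclic = ∀ {u v w} → u ≢ v → v ≢ w → w ≢ u →
            beats T u v ≡ true → beats T v w ≡ true → beats T w u ≡ true → ⊥

induced : ∀ {n k} (T : Tournament n) (f : Fin k → Fin n) → Injective _≡_ _≡_ f → Tournament k
beats (induced T f f-inj) i j = beats T (f i) (f j)
tourn (induced T f f-inj) i j i≢j = tourn T (f i) (f j) (i≢j ∘ f-inj)

acyclic-induced : ∀ {n k} (T : Tournament n) {f : Fin k → Fin n} (f-inj : Injective _≡_ _≡_ f) →
                  Acyclic T → Acyclic (induced T f f-inj)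
acyclic-induced T f-inj acyclic u≢v v≢w w≢u =
  acyclic (u≢v ∘ f-inj) (v≢w ∘ f-inj) (w≢u ∘ f-inj)

Dominates : ∀ {n} → Tournament n → Fin n → Set
Dominates T s = ∀ v → v ≢ s → beats T s v ≡ true

source : ∀ {m} (T : Tournament (suc m)) → Acyclic T → ∃ (Dominates T)
source {zero} T acyclic = zero , λ { zero 0≢0 → ⊥-elim (0≢0 refl) }
source {suc m} T acyclic
  with source (induced T suc suc-injective) (acyclic-induced T suc-injective acyclic)
... | s , s-dominates with beats T (suc s) zero in s→0?
... | true = suc s , λ { zero _ → s→0? ; (suc v) v≢s → s-dominates v (v≢s ∘ cong suc) }
... | false = zero , zero-dominates
  where
  0→s : beats T zero (suc s) ≡ true
  0→s = beats-flip T (λ ()) s→0?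

  zero-dominates : Dominates T zero
  zero-dominates zero 0≢0 = ⊥-elim (0≢0 refl)
  zero-dominates (suc v) _ with v ≟ s
  ... | yes refl = 0→s
  ... | no v≢s with beats T zero (suc v) in 0→v?
  ... | true = refl
  ... | false = ⊥-elim (acyclic (λ ()) (v≢s ∘ sym ∘ suc-injective) (λ ())
                          0→s (s-dominates v v≢s) (beats-flip T (λ ()) 0→v?))

twoDominatingVertices : ∀ {m} (T : Tournament (suc (suc m))) → Acyclic T →
  ∃₂ λ u₁ u₂ → u₁ ≢ u₂ × (∀ v → v ≢ u₁ → v ≢ u₂ → beats T u₁ v ≡ true × beats T u₂ v ≡ true)
twoDominatingVertices T acyclic
  with source T acyclic
... | u₁ , u₁-dominates
  with source (induced T (punchIn u₁) (punchIn-injective u₁ _ _))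
              (acyclic-induced T (punchIn-injective u₁ _ _) acyclic)
... | s , s-dominates =
  u₁ , punchIn u₁ s , punchInᵢ≢i u₁ s ∘ sym ,
  λ v v≢u₁ v≢u₂ → u₁-dominates v v≢u₁ , u₂-dominates v v≢u₁ v≢u₂
  where
  u₂-dominates : ∀ v → v ≢ u₁ → v ≢ punchIn u₁ s → beats T (punchIn u₁ s) v ≡ true
  u₂-dominates v v≢u₁ v≢u₂ =
    subst (λ w → beats T (punchIn u₁ s) w ≡ true) (punchIn-punchOut u₁≢v)
          (s-dominates (punchOut u₁≢v) (v≢u₂ ∘ trans (sym (punchIn-punchOut u₁≢v)) ∘ cong (punchIn u₁)))
    where
    u₁≢v : u₁ ≢ v
    u₁≢v = v≢u₁ ∘ sym

switch : ∀ {n} → Tournament n → (Fin n → Bool) → Tournament n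
beats (switch T X) u v = (X u xor X v) xor beats T u v
tourn (switch T X) u v u≢v = begin
  (X v xor X u) xor beats T v u       ≡⟨ cong₂ _xor_ (xor-comm (X v) (X u)) (tourn T u v u≢v) ⟩
  (X u xor X v) xor not (beats T u v) ≡⟨ not-distribʳ-xor (X u xor X v) (beats T u v) ⟨
  not ((X u xor X v) xor beats T u v) ∎
  where open ≡-Reasoning

switch-twins⇒crAssociated : ∀ {n} (T : Tournament n) (X : Fin n → Bool) {u₁ u₂} →
  (∀ v → v ≢ u₁ → v ≢ u₂ → beats (switch T X) u₁ v ≡ beats (switch T X) u₂ v) →
  CRAssociated T u₁ u₂
switch-twins⇒crAssociated T X {u₁} {u₂} twins with X u₁ Bool.≟ X u₂
... | yes X₁≡X₂ = inj₁ λ v v≢u₁ v≢u₂ →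
  cong sign (xor-cancelˡ (X u₂ xor X v)
    (trans (cong (λ x → (x xor X v) xor beats T u₁ v) (sym X₁≡X₂)) (twins v v≢u₁ v≢u₂)))
... | no X₁≢X₂ = inj₂ λ v v≢u₁ v≢u₂ → begin
  sign (beats T u₁ v)             ≡⟨ cong sign (not-involutive (beats T u₁ v)) ⟨
  sign (not (not (beats T u₁ v))) ≡⟨ cong (sign ∘ not) (xor-cancelˡ (X u₂ xor X v) (beats-twisted v v≢u₁ v≢u₂)) ⟩
  sign (not (beats T u₂ v))       ≡⟨ sign-not (beats T u₂ v) ⟩
  - sign (beats T u₂ v)           ∎
  where
  open ≡-Reasoning
  beats-twisted : ∀ v → v ≢ u₁ → v ≢ u₂ →
                  (X u₂ xor X v) xor not (beats T u₁ v) ≡ (X u₂ xor X v) xor beats T u₂ v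
  beats-twisted v v≢u₁ v≢u₂ = begin
    (X u₂ xor X v) xor not (beats T u₁ v)   ≡⟨ not-distribʳ-xor (X u₂ xor X v) (beats T u₁ v) ⟨
    not ((X u₂ xor X v) xor beats T u₁ v)   ≡⟨ not-distribˡ-xor (X u₂ xor X v) (beats T u₁ v) ⟩
    not (X u₂ xor X v) xor beats T u₁ v     ≡⟨ cong (_xor beats T u₁ v) (not-distribˡ-xor (X u₂) (X v)) ⟩
    (not (X u₂) xor X v) xor beats T u₁ v   ≡⟨ cong (λ x → (x xor X v) xor beats T u₁ v) (Bool.¬-not X₁≢X₂) ⟨
    (X u₁ xor X v) xor beats T u₁ v         ≡⟨ twins v v≢u₁ v≢u₂ ⟩
    (X u₂ xor X v) xor beats T u₂ v         ∎

sumFin-cong : ∀ {n} {f g : Fin n → ℤ} → (∀ i → f i ≡ g i) → sumFin f ≡ sumFin g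
sumFin-cong {zero} _ = refl
sumFin-cong {suc n} f≗g = cong₂ _+_ (f≗g zero) (sumFin-cong (f≗g ∘ suc))

det-cong : ∀ {n} {M N : Fin n → Fin n → ℤ} → (∀ i j → M i j ≡ N i j) → det M ≡ det N
det-cong {zero} _ = refl
det-cong {suc n} M≗N = sumFin-cong λ j →
  cong (sgn (toℕ j) *_) (cong₂ _*_ (M≗N zero j) (det-cong λ r c → M≗N (suc r) (punchIn j c)))

skewFromUpper : ∀ {n} → (Fin n → Fin n → ℤ) → Fin n → Fin n → ℤ
skewFromUpper M zero    zero    = + 0
skewFromUpper M zero    (suc c) = M zero (suc c)
skewFromUpper M (suc r) zero    = - M zero (suc r)
skewFromUpper M (suc r) (suc c) = skewFromUpper (λ i j → M (suc i) (suc j)) r c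

skew≡skewFromUpper : ∀ {n k} (T : Tournament n) {f : Fin k → Fin n} → Injective _≡_ _≡_ f →
  ∀ r c → skew T (f r) (f c) ≡ skewFromUpper (λ i j → θ T (f i) (f j)) r c
skew≡skewFromUpper T {f} f-inj zero zero = skew-diag T (f zero)
skew≡skewFromUpper T f-inj zero (suc c) = skew-offDiag T ((λ ()) ∘ f-inj)
skew≡skewFromUpper T f-inj (suc r) zero =
  trans (skew-offDiag T ((λ ()) ∘ f-inj)) (θ-flip T ((λ ()) ∘ f-inj))
skew≡skewFromUpper T f-inj (suc r) (suc c) = skew≡skewFromUpper T (suc-injective ∘ f-inj) r c

subDet≡det-skewFromUpper : ∀ {n k} (T : Tournament n) {f : Fin k → Fin n} (f-inj : Injective _≡_ _≡_ f) →
  subDet T f ≡ det (skewFromUpper (θ (induced T f f-inj)))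
subDet≡det-skewFromUpper T f-inj = det-cong (skew≡skewFromUpper T f-inj)

outOfZero : ∀ {m} → Tournament (suc m) → Fin (suc m) → Bool
outOfZero T zero    = false
outOfZero T (suc v) = beats T zero (suc v)

sinkSwitch : ∀ {m} → Tournament (suc m) → Tournament (suc m)
sinkSwitch T = switch T (outOfZero T)

arcs₄ : Bool → Bool → Bool → Bool → Bool → Bool → Fin 4 → Fin 4 → Bool
arcs₄ a b c d e g zero                (suc zero)                = a
arcs₄ a b c d e g zero                (suc (suc zero))          = b
arcs₄ a b c d e g zero                (suc (suc (suc zero)))    = c
arcs₄ a b c d e g (suc zero)          (suc (suc zero))          = d
arcs₄ a b c d e g (suc zero)          (suc (suc (suc zero)))    = e
arcs₄ a b c d e g (suc (suc zero))    (suc (suc (suc zero)))    = g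
arcs₄ a b c d e g _                   _                         = false

-- The hypotheses say that 1 → 2 → 3 → 1 is a cyclic triangle after switching at the
-- out-neighbourhood of 0; in each of the eight cases the Pfaffian a g − b e + c d (read as
-- signs) is ±3.
det-arcs₄≡9 : ∀ {a b c d e g} → d ≡ not (a xor b) → e ≡ c xor a → g ≡ not (b xor c) →
  det (skewFromUpper (λ i j → sign (arcs₄ a b c d e g i j))) ≡ + 9
det-arcs₄≡9 {a} {b} {c} refl refl refl = by-cases a b c
  where
  by-cases : ∀ a b c →
    det (skewFromUpper (λ i j → sign (arcs₄ a b c (not (a xor b)) (c xor a) (not (b xor c)) i j))) ≡ + 9
  by-cases true  true  true  = refl
  by-cases true  true  false = refl
  by-cases true  false true  = refl
  by-cases true  false false = refl
  by-cases false true  true  = refl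
  by-cases false true  false = refl
  by-cases false false true  = refl
  by-cases false false false = refl

sinkSwitch-cyclic⇒det≡9 : (T : Tournament 4) →
  let S = sinkSwitch T in
  beats S (suc zero) (suc (suc zero)) ≡ true →
  beats S (suc (suc zero)) (suc (suc (suc zero))) ≡ true →
  beats S (suc (suc (suc zero))) (suc zero) ≡ true →
  det (skewFromUpper (θ T)) ≡ + 9
sinkSwitch-cyclic⇒det≡9 T 1→2 2→3 3→1 =
  det-arcs₄≡9 {a} {b} {c} (xor≡true⇒≡not (a xor b) 1→2)
              (not-injective (trans (sym (tourn T (suc zero) (suc (suc (suc zero))) (λ ())))
                                    (xor≡true⇒≡not (c xor a) 3→1)))
              (xor≡true⇒≡not (b xor c) 2→3)
  where
  a b c : Bool
  a = beats T zero (suc zero)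
  b = beats T zero (suc (suc zero))
  c = beats T zero (suc (suc (suc zero)))

sinkSwitch-zero-loses : ∀ {m} (T : Tournament (suc m)) {v} → v ≢ zero → beats (sinkSwitch T) zero v ≢ true
sinkSwitch-zero-loses T {zero}  0≢0 _ = 0≢0 refl
sinkSwitch-zero-loses T {suc v} _ 0→v with trans (sym (xor-same (beats T zero (suc v)))) 0→v
... | ()

inD1⇒acyclic-sinkSwitch : ∀ {m} (T : Tournament (suc m)) → InD1 T → Acyclic (sinkSwitch T)
inD1⇒acyclic-sinkSwitch T _ {zero} u≢v _   _   0→v _   _   = sinkSwitch-zero-loses T (u≢v ∘ sym) 0→v
inD1⇒acyclic-sinkSwitch T _ {_} {zero} _ v≢w _   _   0→w _   = sinkSwitch-zero-loses T (v≢w ∘ sym) 0→w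
inD1⇒acyclic-sinkSwitch T _ {_} {_} {zero} _ _ w≢u _   _   0→u = sinkSwitch-zero-loses T (w≢u ∘ sym) 0→u
inD1⇒acyclic-sinkSwitch {m} T inD1 {suc i} {suc j} {suc k} u≢v v≢w w≢u u→v v→w w→u =
  9≰1 (subst (_≤ + 1) subDet≡9 (inD1 4 quad quad-inj))
  where
  vertices : Vec (Fin (suc m)) 4
  vertices = zero ∷ suc i ∷ suc j ∷ suc k ∷ []

  distinct : Unique vertices
  distinct = ((λ ()) ∷ (λ ()) ∷ (λ ()) ∷ []) ∷ (u≢v ∷ (w≢u ∘ sym) ∷ []) ∷ (v≢w ∷ []) ∷ [] ∷ []

  quad : Fin 4 → Fin (suc m)
  quad = lookup vertices

  quad-inj : Injective _≡_ _≡_ quad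
  quad-inj = lookup-injective distinct _ _

  subDet≡9 : subDet T quad ≡ + 9
  subDet≡9 = trans (subDet≡det-skewFromUpper T quad-inj)
                   (sinkSwitch-cyclic⇒det≡9 (induced T quad quad-inj) u→v v→w w→u)

  9≰1 : ¬ (+ 9 ≤ + 1)
  9≰1 (+≤+ (s≤s ()))

proposition4p10 : ∀ {n : ℕ} (T : Tournament n) → Basic T → ¬ InD1 T
proposition4p10 {suc (suc _)} T (s≤s (s≤s _) , no-crAssociated) inD1 =
  let u₁ , u₂ , u₁≢u₂ , dominate = twoDominatingVertices (sinkSwitch T) (inD1⇒acyclic-sinkSwitch T inD1)
  in no-crAssociated u₁ u₂ u₁≢u₂ (switch-twins⇒crAssociated T (outOfZero T) λ v v≢u₁ v≢u₂ →
       let u₁→v , u₂→v = dominate v v≢u₁ v≢u₂ in trans u₁→v (sym u₂→v))
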